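{- Let $q$ be a prime power, $n\ge1$, $x_1,\dots,x_n$ positive reals with sum $1$, $G=\mathrm{GL}_n(\mathbb{F}_q)$, and $h\in B^-$. Then for every $g\in G$, \[ h\big(gB\cdot\mathcal{T}_{G/B}(q,{\sf x})\big)=\big((hg)B\big)\cdot\mathcal{T}_{G/B}(q,{\sf x}), \] where $h$ acts on linear combinations of cosets by left multiplication on each coset.
   Context: $B$ (resp. $B^-$) is the group of invertible upper (resp. lower) triangular matrices. A coset $gB$ is identified with the complete flag $(V_0\subseteq V_1\subseteq\cdots\subseteq V_n)$ where $V_i$ is the span of the first $i$ columns of $g$; left multiplication by $h$ maps $V_i$ to $hV_i$. Each line of $\mathbb{F}_q^n$ is uniquely $L=\langle e_i+\sum_{k>i}c_ke_k\rangle$ (standard basis $e_k$), with weight $y(L)=x_i/q^{n-i}$. The operator $\mathcal{T}_{G/B}(q,{\sf x})$ on the vector space with basis the complete flags is $F\cdot\mathcal{T}_{G/B}(q,{\sf x})=\sum_{\text{lines }L}y(L)F_L$, with $F_L=(V_0\subseteq L\subseteq V_1+L\subseteq\cdots\subseteq V_{n-1}+L\subseteq V_n)$ with the repeated subspace removed. -}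

module Defs where

open import Level using (Level; _⊔_) renaming (suc to lsuc)
open import Data.Nat as ℕ using (ℕ; zero; suc; _∸_)
open import Data.Fin as Fin using (Fin; zero; suc; toℕ; inject!; _≟_)
open import Data.List as List using (List; []; _∷_; _++_; map; concatMap; foldr; length)
open import Data.List.Relation.Unary.Any using (Any)
open import Data.List.Relation.Unary.AllPairs using (AllPairs)
open import Data.Vec.Functional as VF using (Vector)
open import Data.Product using (Σ; ∃; _×_; _,_; proj₁; proj₂)
open import Relation.Nullary using (¬_; does)
open import Data.Bool using (if_then_else_)
open import Algebra.Bundles using (CommutativeRing)
open import Relation.Binary.PropositionalEquality using (_≡_)

record Field (c ℓ : Level) : Set (lsuc (c ⊔ ℓ)) where
  field
    commutativeRing : CommutativeRing c ℓ
  open CommutativeRing commutativeRing public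
  field
    1≉0     : ¬ (1# ≈ 0#)
    inverse : ∀ x → ¬ (x ≈ 0#) → ∃ λ y → (x * y) ≈ 1#

record HasOrder {c ℓ} (K : Field c ℓ) (q : ℕ) : Set (c ⊔ ℓ) where
  open Field K using (Carrier; _≈_)
  field
    elems    : List Carrier
    length≡q : length elems ≡ q
    complete : ∀ a → Any (a ≈_) elems
    distinct : AllPairs (λ a b → ¬ (a ≈ b)) elems

module LinAlg {c ℓ} (K : Field c ℓ) where
  open Field K using (Carrier; _≈_; _+_; _*_; 0#; 1#)

  ∑ : ∀ {m} → (Fin m → Carrier) → Carrier
  ∑ {zero}  f = 0#
  ∑ {suc m} f = f zero + ∑ (λ j → f (suc j))

  Vec : ℕ → Set c
  Vec n = Fin n → Carrier

  Mat : ℕ → Set c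
  Mat n = Fin n → Fin n → Carrier

  _⊗_ : ∀ {n} → Mat n → Mat n → Mat n
  (A ⊗ B) i j = ∑ (λ k → A i k * B k j)

  _·_ : ∀ {n} → Mat n → Vec n → Vec n
  (A · v) i = ∑ (λ k → A i k * v k)

  I : ∀ {n} → Mat n
  I i j = if does (i ≟ j) then 1# else 0#

  _≈M_ : ∀ {n} → Mat n → Mat n → Set ℓ
  A ≈M B = ∀ i j → A i j ≈ B i j

  IsInvertible : ∀ {n} → Mat n → Set (c ⊔ ℓ)
  IsInvertible A = Σ (Mat _) λ A' → ((A ⊗ A') ≈M I) × ((A' ⊗ A) ≈M I)

  IsLowerTriangular : ∀ {n} → Mat n → Set ℓ
  IsLowerTriangular A = ∀ i j → toℕ i ℕ.< toℕ j → A i j ≈ 0#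

  InBminus : ∀ {n} → Mat n → Set (c ⊔ ℓ)
  InBminus A = IsInvertible A × IsLowerTriangular A

  -- A subspace of K^n, given as the span of a finite family of vectors.
  Subspace : ℕ → Set c
  Subspace n = Σ ℕ λ m → Fin m → Vec n

  _∈S_ : ∀ {n} → Vec n → Subspace n → Set (c ⊔ ℓ)
  v ∈S (m , vs) = Σ (Fin m → Carrier) λ a → ∀ k → v k ≈ ∑ (λ j → a j * vs j k)

  _≐_ : ∀ {n} → Subspace n → Subspace n → Set (c ⊔ ℓ)
  U ≐ W = ∀ v → ((v ∈S U → v ∈S W) × (v ∈S W → v ∈S U))

  _+line_ : ∀ {n} → Subspace n → Vec n → Subspace n
  (m , vs) +line l = (suc m , l VF.∷ vs)

  _▹_ : ∀ {n} → Mat n → Subspace n → Subspace n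
  h ▹ (m , vs) = (m , λ j → h · vs j)

  -- A flag is a finite chain of subspaces; it is determined by the SET of
  -- subspaces occurring in it, so flags are compared as such sets (this
  -- is how "with the repeated subspace removed" is handled).
  Flag : ℕ → Set c
  Flag n = Σ ℕ λ k → Fin k → Subspace n

  _≈F_ : ∀ {n} → Flag n → Flag n → Set (c ⊔ ℓ)
  (k , U) ≈F (k' , W) = (∀ a → ∃ λ b → U a ≐ W b) × (∀ b → ∃ λ a → U a ≐ W b)

  CFlag : ℕ → Set c
  CFlag n = Fin (suc n) → Subspace n

  toFlag : ∀ {n} → CFlag n → Flag n
  toFlag {n} V = (suc n , V)

  -- the flag of the coset gB: Vᵢ = span of the first i columns of g
  cosetFlag : ∀ {n} → Mat n → CFlag n
  cosetFlag g i = (toℕ i , λ j r → g r (inject! j))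

  -- F_L = (V₀ ⊆ L ⊆ V₁+L ⊆ ⋯ ⊆ V_{n-1}+L ⊆ Vₙ(=Vₙ+L)); as a set of
  -- subspaces, the repeated subspace is automatically identified.
  flagL : ∀ {n} → CFlag n → Vec n → Flag n
  flagL {n} V l = (suc (suc n) , λ { zero → (0 , λ ()) ; (suc k) → V k +line l })

  actFlag : ∀ {n} → Mat n → Flag n → Flag n
  actFlag h (k , U) = (k , λ a → h ▹ U a)

  allVecs : List Carrier → (m : ℕ) → List (Vec m)
  allVecs es zero    = VF.[] ∷ []
  allVecs es (suc m) = concatMap (λ a → map (a VF.∷_) (allVecs es m)) es

  -- all lines of K^n, each given by its unique generator
  -- e_i + ∑_{k>i} c_k e_k, together with its pivot i (0-indexed)
  lines : List Carrier → (n : ℕ) → List (Fin n × Vec n)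
  lines es zero    = []
  lines es (suc m) =
    map (λ t → (zero , 1# VF.∷ t)) (allVecs es m)
    ++ map (λ p → (suc (proj₁ p) , 0# VF.∷ proj₂ p)) (lines es m)

module Operator {c ℓ c' ℓ'} (K : Field c ℓ) (R : CommutativeRing c' ℓ') where
  open LinAlg K
  open Field K using (Carrier)
  module R = CommutativeRing R

  LinComb : ℕ → Set (c ⊔ c')
  LinComb n = List (R.Carrier × Flag n)

  eval : ∀ {n} → (Flag n → R.Carrier) → LinComb n → R.Carrier
  eval φ = foldr (λ t acc → (proj₁ t R.* φ (proj₂ t)) R.+ acc) R.0#

  -- equality in the free R-module on flags (flags up to ≈F): two formal
  -- sums are equal iff every function on the basis pairs equally with them
  _≈L_ : ∀ {n} → LinComb n → LinComb n → Set (c ⊔ ℓ ⊔ c' ⊔ ℓ')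
  _≈L_ {n} A B = (φ : Flag n → R.Carrier) →
                 (∀ F F' → F ≈F F' → φ F R.≈ φ F') →
                 eval φ A R.≈ eval φ B

  act : ∀ {n} → Mat n → LinComb n → LinComb n
  act h = map (λ t → (proj₁ t , actFlag h (proj₂ t)))

  natR : ℕ → R.Carrier
  natR zero    = R.0#
  natR (suc k) = R.1# R.+ natR k

  powR : R.Carrier → ℕ → R.Carrier
  powR a zero    = R.1#
  powR a (suc k) = a R.* powR a k

  ∑R : ∀ {m} → (Fin m → R.Carrier) → R.Carrier
  ∑R {zero}  f = R.0#
  ∑R {suc m} f = f zero R.+ ∑R (λ j → f (suc j))

  -- weight y(L) = x_i / q^{n-i} (i 1-indexed; pivot p = i - 1), where
  -- qinv is the inverse of q in R
  weight : ∀ {n} → (Fin n → R.Carrier) → R.Carrier → Fin n → R.Carrier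
  weight {n} x qinv p = x p R.* powR qinv (n ∸ suc (toℕ p))

  -- F · T_{G/B}(q,x) = ∑_L y(L) F_L
  T : ∀ {n} → List Carrier → (Fin n → R.Carrier) → R.Carrier →
      CFlag n → LinComb n
  T {n} es x qinv V =
    map (λ p → (weight x qinv (proj₁ p) , flagL V (proj₂ p))) (lines es n)

open import Data.Nat.Primality using (Prime)

IsPrimePower : ℕ → Set
IsPrimePower q = Σ ℕ λ p → Σ ℕ λ k → Prime p × (q ≡ p ℕ.^ suc k)

-- An element h of B⁻ permutes the lines of K^n without moving their pivots. If l is the
-- normalised generator of L with pivot p, then h·l vanishes before p and its p-th entry is
-- h_pp, a unit whose inverse is the p-th diagonal entry of h⁻¹ (by triangularity). So hL has
-- pivot p, hence the weight of L, and normalised generator h_pp⁻¹·h·l; as L ↦ hL is injective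
-- on the finite set of lines it is a bijection. Since h·F_L = (hF)_{hL}, reindexing the sum
-- over L by L ↦ hL gives the identity.
module Submission where

open import Defs
open import Level using (Level)
open import Data.Nat as ℕ using (ℕ; _≤_; zero; suc)
import Data.Nat.Properties as ℕ
open import Data.Fin using (Fin; zero; suc; _<_)
open import Data.Fin.Properties using (<-cmp; <-trans; suc-injective)
open import Data.Product using (_×_; _,_; proj₁; proj₂)
open import Data.Product.Relation.Binary.Pointwise.NonDependent using (_×ₛ_)
open import Data.Sum using (_⊎_; inj₁; inj₂)
open import Algebra.Bundles using (CommutativeRing; CommutativeMonoid)
import Algebra.Properties.Ring as RingProperties
open import Data.List
  using (List; []; _∷_; _++_; length; map; foldr; concatMap; cartesianProductWith)
open import Data.List.Properties using (map-∘; length-map; foldr-map)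
open import Data.List.Relation.Unary.All as All using (All; []; _∷_)
import Data.List.Relation.Unary.All.Properties as Allₚ
open import Data.List.Relation.Unary.AllPairs using ([]; _∷_)
open import Data.List.Relation.Unary.Any using (here; there)
open import Data.List.Relation.Unary.Unique.Setoid using (Unique)
import Data.List.Relation.Unary.Unique.Setoid.Properties as Uniqueₚ
import Data.List.Relation.Binary.Permutation.Setoid as Permutation
import Data.List.Relation.Binary.Permutation.Setoid.Properties as Permutationₚ
open import Data.List.Membership.Setoid using (_∈_)
open import Data.List.Membership.Setoid.Properties
  using (∈-∃++; ∈-resp-≈; ∈-resp-≋; ∈-++⁻; ∈-++⁺ˡ; ∈-++⁺ʳ; ∈-map⁺; ∈-map⁻; ∈-cartesianProductWith⁺)
import Data.Vec.Functional as VF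
import Data.Vec.Functional.Relation.Binary.Equality.Setoid as VecEquality
open import Function using (_∘_; id)
open import Relation.Binary.Bundles using (Setoid)
open import Relation.Binary.Core using (_Preserves_⟶_)
open import Relation.Binary.Definitions using (tri<; tri≈; tri>)
import Relation.Binary.PropositionalEquality as ≡
open ≡ using (_≡_; _≢_)
import Relation.Binary.Reasoning.Setoid as SetoidReasoning
open import Relation.Nullary using (¬_; contradiction)

concatMap-map≡cartesianProductWith : ∀ {a b c} {A : Set a} {B : Set b} {C : Set c}
  (f : A → B → C) xs ys → concatMap (λ x → map (f x) ys) xs ≡ cartesianProductWith f xs ys
concatMap-map≡cartesianProductWith f []       ys = ≡.refl
concatMap-map≡cartesianProductWith f (x ∷ xs) ys =
  ≡.cong (map (f x) ys ++_) (concatMap-map≡cartesianProductWith f xs ys)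

module _ {a ℓ} (S : Setoid a ℓ) where
  open Setoid S
  open Permutation S using (_↭_; ↭-refl; ↭-trans; ↭-reflexive-≋; prep)
  open Permutationₚ S using (shift; xs↭ys⇒|xs|≡|ys|)

  ↭-unique-⊆ : ∀ {xs ys} → Unique S ys → length xs ≡ length ys → All (λ y → _∈_ S y xs) ys →
               xs ↭ ys
  ↭-unique-⊆ {[]}    {[]}     _ _ _ = ↭-refl
  ↭-unique-⊆ {_ ∷ _} {[]}     _ () _
  ↭-unique-⊆ {xs}    {y ∷ ys} (y≉ys ∷ ys!) |xs|≡ (y∈xs ∷ ys⊆xs)
    with as , bs , w , y≈w , xs≋ ← ∈-∃++ S y∈xs =
    ↭-trans xs↭w∷as++bs
      (prep (sym y≈w) (↭-unique-⊆ ys! |as++bs|≡ (All.zipWith remove-w (y≉ys , ys⊆xs))))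
    where
    xs↭w∷as++bs : xs ↭ w ∷ as ++ bs
    xs↭w∷as++bs = ↭-trans (↭-reflexive-≋ xs≋) (shift refl as bs)
    |as++bs|≡ : length (as ++ bs) ≡ length ys
    |as++bs|≡ = ℕ.suc-injective (≡.trans (≡.sym (xs↭ys⇒|xs|≡|ys| xs↭w∷as++bs)) |xs|≡)
    remove-w : ∀ {z} → ¬ (y ≈ z) × _∈_ S z xs → _∈_ S z (as ++ bs)
    remove-w (y≉z , z∈xs) with ∈-++⁻ S as (∈-resp-≋ S xs≋ z∈xs)
    ... | inj₁ z∈as         = ∈-++⁺ˡ S z∈as
    ... | inj₂ (here z≈w)   = contradiction (trans y≈w (sym z≈w)) y≉z
    ... | inj₂ (there z∈bs) = ∈-++⁺ʳ S as z∈bs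

module ListSum {c ℓ} (M : CommutativeMonoid c ℓ) where
  open CommutativeMonoid M

  sumMap : ∀ {a} {A : Set a} → (A → Carrier) → List A → Carrier
  sumMap f xs = foldr _∙_ ε (map f xs)

  sumMap-cong : ∀ {a} {A : Set a} {f g : A → Carrier} → (∀ x → f x ≈ g x) → ∀ xs →
                sumMap f xs ≈ sumMap g xs
  sumMap-cong f≈g []       = refl
  sumMap-cong f≈g (x ∷ xs) = ∙-cong (f≈g x) (sumMap-cong f≈g xs)

  sumMap-↭ : ∀ {a ℓ′} (S : Setoid a ℓ′) {f : Setoid.Carrier S → Carrier} →
             f Preserves Setoid._≈_ S ⟶ _≈_ → ∀ {xs ys} → Permutation._↭_ S xs ys →
             sumMap f xs ≈ sumMap f ys
  sumMap-↭ S pres xs↭ys =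
    Permutationₚ.foldr-commMonoid setoid isCommutativeMonoid (Permutationₚ.map⁺ S setoid pres xs↭ys)

module LinearAlgebra {c ℓ} (K : Field c ℓ) where
  open Field K hiding (zero)
  open LinAlg K
  open VecEquality setoid using (_≋_)
  open RingProperties ring using (+-cancelˡ)
  open SetoidReasoning setoid

  ∑-zero : ∀ {m} {f : Fin m → Carrier} → (∀ j → f j ≈ 0#) → ∑ f ≈ 0#
  ∑-zero {zero}  f≈0 = refl
  ∑-zero {suc m} f≈0 = trans (+-cong (f≈0 zero) (∑-zero (f≈0 ∘ suc))) (+-identityˡ 0#)

  ∑-single : ∀ {m} {f : Fin m → Carrier} p → (∀ j → j ≢ p → f j ≈ 0#) → ∑ f ≈ f p
  ∑-single {suc m} zero    f≈0 =
    trans (+-congˡ (∑-zero λ j → f≈0 (suc j) λ ())) (+-identityʳ _)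
  ∑-single {suc m} (suc p) f≈0 =
    trans (+-cong (f≈0 zero λ ()) (∑-single p λ j j≢p → f≈0 (suc j) (j≢p ∘ suc-injective)))
          (+-identityˡ _)

  unit-cancel : ∀ {a b} → a * b ≈ 1# → ∀ x → a * (b * x) ≈ x
  unit-cancel {a} {b} ab≈1 x = begin
    a * (b * x) ≈⟨ *-assoc a b x ⟨
    a * b * x   ≈⟨ *-congʳ ab≈1 ⟩
    1# * x      ≈⟨ *-identityˡ x ⟩
    x           ∎

  *-cancelˡ-unit : ∀ {a b x y} → a * b ≈ 1# → a * x ≈ a * y → x ≈ y
  *-cancelˡ-unit {a} {b} {x} {y} ab≈1 ax≈ay = begin
    x           ≈⟨ unit-cancel ba≈1 x ⟨
    b * (a * x) ≈⟨ *-congˡ ax≈ay ⟩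
    b * (a * y) ≈⟨ unit-cancel ba≈1 y ⟩
    y           ∎
    where ba≈1 = trans (*-comm b a) ab≈1

  module _ {n} {h : Mat n} (lt : IsLowerTriangular h) {p : Fin n} {l : Vec n}
           (l≈0 : ∀ j → j < p → l j ≈ 0#) where

    private
      term≈0 : ∀ {j k} → j < k ⊎ k < p → h j k * l k ≈ 0#
      term≈0 (inj₁ j<k) = trans (*-congʳ (lt _ _ j<k)) (zeroˡ _)
      term≈0 (inj₂ k<p) = trans (*-congˡ (l≈0 _ k<p)) (zeroʳ _)

    ·-vanishes-before : ∀ j → j < p → (h · l) j ≈ 0#
    ·-vanishes-before j j<p = ∑-zero λ k → term≈0 (split k)
      where
      split : ∀ k → j < k ⊎ k < p
      split k with <-cmp j k
      ... | tri< j<k _ _    = inj₁ j<k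
      ... | tri≈ _ ≡.refl _ = inj₂ j<p
      ... | tri> _ _ k<j    = inj₂ (<-trans k<j j<p)

    ·-pivot : (h · l) p ≈ h p p * l p
    ·-pivot = ∑-single p λ k k≢p → term≈0 (split k k≢p)
      where
      split : ∀ k → k ≢ p → p < k ⊎ k < p
      split k k≢p with <-cmp p k
      ... | tri< p<k _ _    = inj₁ p<k
      ... | tri≈ _ p≡k _    = contradiction (≡.sym p≡k) k≢p
      ... | tri> _ _ k<p    = inj₂ k<p

  ·-head : ∀ {n} {h : Mat (suc n)} → IsLowerTriangular h → ∀ v →
           (h · v) zero ≈ h zero zero * v zero
  ·-head lt v = ·-pivot lt {l = v} λ _ ()

  minor₀₀ : ∀ {n} → Mat (suc n) → Mat n
  minor₀₀ A i j = A (suc i) (suc j)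

  minor₀₀-lowerTriangular : ∀ {n} {h : Mat (suc n)} → IsLowerTriangular h →
                            IsLowerTriangular (minor₀₀ h)
  minor₀₀-lowerTriangular lt i j i<j = lt (suc i) (suc j) (ℕ.s<s i<j)

  -- Row 0 of h is (h₀₀, 0, …, 0), so h₀₀ h⁻¹₀₀ = 1 and h⁻¹₀ⱼ = 0 for j > 0; the latter makes
  -- the lower-right minors of h and h⁻¹ inverse to each other again.
  lowerTriangular-diagonal-inverse : ∀ {n} {h h⁻¹ : Mat n} → IsLowerTriangular h →
    (h ⊗ h⁻¹) ≈M I → ∀ p → h p p * h⁻¹ p p ≈ 1#
  lowerTriangular-diagonal-inverse {suc n} {h} {h⁻¹} lt hh⁻¹≈I = λ where
      zero    → h₀₀h⁻¹₀₀≈1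
      (suc p) → lowerTriangular-diagonal-inverse (minor₀₀-lowerTriangular lt) minor-inverse p
    where
    h₀₀h⁻¹₀₀≈1 : h zero zero * h⁻¹ zero zero ≈ 1#
    h₀₀h⁻¹₀₀≈1 = trans (sym (·-head lt (λ k → h⁻¹ k zero))) (hh⁻¹≈I zero zero)
    h⁻¹₀ⱼ≈0 : ∀ j → h⁻¹ zero (suc j) ≈ 0#
    h⁻¹₀ⱼ≈0 j = *-cancelˡ-unit h₀₀h⁻¹₀₀≈1 (begin
      h zero zero * h⁻¹ zero (suc j) ≈⟨ ·-head lt (λ k → h⁻¹ k (suc j)) ⟨
      (h ⊗ h⁻¹) zero (suc j)         ≈⟨ hh⁻¹≈I zero (suc j) ⟩
      0#                             ≈⟨ zeroʳ _ ⟨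
      h zero zero * 0#               ∎)
    minor-inverse : (minor₀₀ h ⊗ minor₀₀ h⁻¹) ≈M I
    minor-inverse i j = begin
      (minor₀₀ h ⊗ minor₀₀ h⁻¹) i j                                     ≈⟨ +-identityˡ _ ⟨
      0# + (minor₀₀ h ⊗ minor₀₀ h⁻¹) i j                                ≈⟨ +-congʳ h₁₀h⁻¹₀₁≈0 ⟨
      h (suc i) zero * h⁻¹ zero (suc j) + (minor₀₀ h ⊗ minor₀₀ h⁻¹) i j ≈⟨ hh⁻¹≈I (suc i) (suc j) ⟩
      I i j                                                             ∎
      where h₁₀h⁻¹₀₁≈0 = trans (*-congˡ (h⁻¹₀ⱼ≈0 j)) (zeroʳ _)

  ·-injective : ∀ {n} {h : Mat n} {d : Vec n} → IsLowerTriangular h → (∀ p → h p p * d p ≈ 1#) →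
                ∀ {u v} → (h · u) ≋ (h · v) → u ≋ v
  ·-injective {suc n} {h} lt hd≈1 {u} {v} hu≈hv = λ where
      zero    → u₀≈v₀
      (suc i) → ·-injective (minor₀₀-lowerTriangular lt) (hd≈1 ∘ suc) minor-eq i
    where
    u₀≈v₀ : u zero ≈ v zero
    u₀≈v₀ = *-cancelˡ-unit (hd≈1 zero)
      (trans (sym (·-head lt u)) (trans (hu≈hv zero) (·-head lt v)))
    minor-eq : (minor₀₀ h · (u ∘ suc)) ≋ (minor₀₀ h · (v ∘ suc))
    minor-eq i = +-cancelˡ (h (suc i) zero * u zero) _ _
      (trans (hu≈hv (suc i)) (+-congʳ (*-congˡ (sym u₀≈v₀))))

  Normalised : ∀ {n} → Fin n × Vec n → Set ℓ
  Normalised (p , l) = (∀ j → j < p → l j ≈ 0#) × l p ≈ 1#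

  scaled-·-normalised : ∀ {n} {h : Mat n} {p l d} → IsLowerTriangular h → h p p * d ≈ 1# →
                        Normalised (p , l) → Normalised (p , λ i → d * (h · l) i)
  scaled-·-normalised {h = h} {p} {l} {d} lt hd≈1 (l≈0 , lₚ≈1) =
    (λ j j<p → trans (*-congˡ (·-vanishes-before lt l≈0 j j<p)) (zeroʳ d)) , (begin
      d * (h · l) p     ≈⟨ *-congˡ (·-pivot lt l≈0) ⟩
      d * (h p p * l p) ≈⟨ *-congˡ (trans (*-congˡ lₚ≈1) (*-identityʳ _)) ⟩
      d * h p p         ≈⟨ *-comm d _ ⟩
      h p p * d         ≈⟨ hd≈1 ⟩
      1#                ∎)

  +line-⊆ : ∀ {n} (U : Subspace n) {u v : Vec n} a → (∀ k → u k ≈ a * v k) →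
            ∀ {w} → w ∈S (U +line u) → w ∈S (U +line v)
  +line-⊆ U a u≈av (c , w≈) =
    (c zero * a) VF.∷ (c ∘ suc) ,
    λ k → trans (w≈ k) (+-congʳ (trans (*-congˡ (u≈av k)) (sym (*-assoc _ a _))))

  +line-≐ : ∀ {n} (U : Subspace n) {u v : Vec n} a b →
            (∀ k → u k ≈ a * v k) → (∀ k → v k ≈ b * u k) → (U +line u) ≐ (U +line v)
  +line-≐ U a b u≈av v≈bu w = +line-⊆ U a u≈av , +line-⊆ U b v≈bu

  pointwise-≈F : ∀ {n k} {U W : Fin k → Subspace n} → (∀ i → U i ≐ W i) → (k , U) ≈F (k , W)
  pointwise-≈F U≐W = (λ i → i , U≐W i) , (λ i → i , U≐W i)

  flagL-cong : ∀ {n} (V : CFlag n) {u v : Vec n} a b →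
               (∀ k → u k ≈ a * v k) → (∀ k → v k ≈ b * u k) → flagL V u ≈F flagL V v
  flagL-cong V a b u≈av v≈bu = pointwise-≈F λ where
    zero    _ → id , id
    (suc i)   → +line-≐ (V i) a b u≈av v≈bu

  flagL-resp-≋ : ∀ {n} (V : CFlag n) {u v : Vec n} → u ≋ v → flagL V u ≈F flagL V v
  flagL-resp-≋ V u≋v = flagL-cong V 1# 1#
    (λ k → trans (u≋v k) (sym (*-identityˡ _))) (λ k → trans (sym (u≋v k)) (sym (*-identityˡ _)))

  actFlag-flagL : ∀ {n} (h : Mat n) (V : CFlag n) l →
                  actFlag h (flagL V l) ≈F flagL (λ i → h ▹ V i) (h · l)
  actFlag-flagL h V l = pointwise-≈F λ where
    zero    _ → id , id
    (suc i) _ → id , id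

module Lines {c ℓ} (K : Field c ℓ) {es : List (Field.Carrier K)}
  (es-complete : ∀ a → _∈_ (Field.setoid K) a es) (es-unique : Unique (Field.setoid K) es) where
  open Field K hiding (zero)
  open LinAlg K
  open LinearAlgebra K using (Normalised)
  open VecEquality setoid using (_≋_; ≋-setoid)

  Pivoted : ℕ → Setoid _ _
  Pivoted n = ≡.setoid (Fin n) ×ₛ ≋-setoid n

  ∷-cong : ∀ {m a b} {t u : Vec m} → a ≈ b → t ≋ u → (a VF.∷ t) ≋ (b VF.∷ u)
  ∷-cong a≈b t≋u zero    = a≈b
  ∷-cong a≈b t≋u (suc i) = t≋u i

  ∷-tail : ∀ {m a} {t : Vec (suc m)} → a ≈ t zero → (a VF.∷ (t ∘ suc)) ≋ t
  ∷-tail a≈t₀ zero    = a≈t₀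
  ∷-tail a≈t₀ (suc i) = refl

  allVecs-suc : ∀ m → allVecs es (suc m) ≡ cartesianProductWith VF._∷_ es (allVecs es m)
  allVecs-suc m = concatMap-map≡cartesianProductWith VF._∷_ es (allVecs es m)

  allVecs-complete : ∀ m (t : Vec m) → _∈_ (≋-setoid m) t (allVecs es m)
  allVecs-complete zero    t = here λ ()
  allVecs-complete (suc m) t =
    ≡.subst (_∈_ (≋-setoid (suc m)) t) (≡.sym (allVecs-suc m))
      (∈-resp-≈ (≋-setoid (suc m)) (∷-tail refl)
        (∈-cartesianProductWith⁺ setoid (≋-setoid m) (≋-setoid (suc m)) ∷-cong
          (es-complete (t zero)) (allVecs-complete m (t ∘ suc))))

  allVecs-unique : ∀ m → Unique (≋-setoid m) (allVecs es m)
  allVecs-unique zero    = [] ∷ []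
  allVecs-unique (suc m) =
    ≡.subst (Unique (≋-setoid (suc m))) (≡.sym (allVecs-suc m))
      (Uniqueₚ.cartesianProductWith⁺ setoid (≋-setoid m) (≋-setoid (suc m)) VF._∷_
        (λ t≋u → t≋u zero , t≋u ∘ suc) es-unique (allVecs-unique m))

  lines-normalised : ∀ n → All Normalised (lines es n)
  lines-normalised zero    = []
  lines-normalised (suc m) =
    Allₚ.++⁺ (Allₚ.map⁺ (All.universal (λ _ → (λ _ ()) , refl) (allVecs es m)))
             (Allₚ.map⁺ (All.map shift (lines-normalised m)))
    where
    shift : ∀ {y} → Normalised y → Normalised (suc (proj₁ y) , 0# VF.∷ proj₂ y)
    shift (l≈0 , lₚ≈1) = (λ { zero _ → refl ; (suc j) (ℕ.s<s j<p) → l≈0 j j<p }) , lₚ≈1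

  lines-complete : ∀ {n} {y : Fin n × Vec n} → Normalised y → _∈_ (Pivoted n) y (lines es n)
  lines-complete {suc m} {zero , l} (_ , l₀≈1) =
    ∈-++⁺ˡ (Pivoted (suc m)) (∈-resp-≈ (Pivoted (suc m)) (≡.refl , ∷-tail (sym l₀≈1))
      (∈-map⁺ (≋-setoid m) (Pivoted (suc m)) (λ t≋u → ≡.refl , ∷-cong refl t≋u)
        (allVecs-complete m (l ∘ suc))))
  lines-complete {suc m} {suc p , l} (l≈0 , lₚ≈1) =
    ∈-++⁺ʳ (Pivoted (suc m)) _
      (∈-resp-≈ (Pivoted (suc m)) (≡.refl , ∷-tail (sym (l≈0 zero ℕ.z<s)))
      (∈-map⁺ (Pivoted m) (Pivoted (suc m)) (λ (p≡q , t≋u) → ≡.cong suc p≡q , ∷-cong refl t≋u)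
        (lines-complete ((λ j j<p → l≈0 (suc j) (ℕ.s<s j<p)) , lₚ≈1))))

  lines-unique : ∀ n → Unique (Pivoted n) (lines es n)
  lines-unique zero    = []
  lines-unique (suc m) =
    Uniqueₚ.++⁺ (Pivoted (suc m))
      (Uniqueₚ.map⁺ (≋-setoid m) (Pivoted (suc m)) (λ (_ , t≋u) → t≋u ∘ suc) (allVecs-unique m))
      (Uniqueₚ.map⁺ (Pivoted m) (Pivoted (suc m))
        (λ (p≡q , t≋u) → suc-injective p≡q , t≋u ∘ suc) (lines-unique m))
      pivots-differ
    where
    pivots-differ : ∀ {y} → ¬ (_∈_ (Pivoted (suc m)) y (map (λ t → zero , 1# VF.∷ t) (allVecs es m))
                             × _∈_ (Pivoted (suc m)) y
                                   (map (λ z → suc (proj₁ z) , 0# VF.∷ proj₂ z) (lines es m)))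
    pivots-differ (y∈top , y∈rest)
      with _ , _ , (y₀≡zero , _) ← ∈-map⁻ (≋-setoid m) (Pivoted (suc m)) y∈top
         | _ , _ , (y₀≡suc , _)  ← ∈-map⁻ (Pivoted m) (Pivoted (suc m)) y∈rest
      with () ← ≡.trans (≡.sym y₀≡zero) y₀≡suc

module Equivariance {c ℓ c' ℓ'} (K : Field c ℓ) (R : CommutativeRing c' ℓ')
  {es : List (Field.Carrier K)}
  (es-complete : ∀ a → _∈_ (Field.setoid K) a es) (es-unique : Unique (Field.setoid K) es) where
  open Field K hiding (zero)
  open LinAlg K
  open Operator K R
  open LinearAlgebra K
  open Lines K es-complete es-unique
  open ListSum R.+-commutativeMonoid

  eval-map : ∀ {a} {A : Set a} {n} (φ : Flag n → R.Carrier) (e : A → R.Carrier × Flag n) xs →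
             eval φ (map e xs) ≡ sumMap (λ y → proj₁ (e y) R.* φ (proj₂ (e y))) xs
  eval-map φ e xs = ≡.trans (foldr-map _ e R.0# xs) (≡.sym (foldr-map R._+_ _ R.0# xs))

  module _ {n} {h h⁻¹ : Mat n} (lt : IsLowerTriangular h) (hh⁻¹≈I : (h ⊗ h⁻¹) ≈M I) where
    open Setoid (Pivoted n) using () renaming (_≈_ to _≈ₚ_)

    private
      hd≈1 : ∀ p → h p p * h⁻¹ p p ≈ 1#
      hd≈1 = lowerTriangular-diagonal-inverse lt hh⁻¹≈I

    hLine : Fin n × Vec n → Fin n × Vec n
    hLine (p , l) = p , λ i → h⁻¹ p p * (h · l) i

    hLine-injective : ∀ {y z} → hLine y ≈ₚ hLine z → y ≈ₚ z
    hLine-injective {p , _} (≡.refl , e) =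
      ≡.refl , ·-injective lt hd≈1 (λ i → *-cancelˡ-unit (trans (*-comm _ _) (hd≈1 p)) (e i))

    lines-↭-map-hLine : Permutation._↭_ (Pivoted n) (lines es n) (map hLine (lines es n))
    lines-↭-map-hLine = ↭-unique-⊆ (Pivoted n)
      (Uniqueₚ.map⁺ (Pivoted n) (Pivoted n) hLine-injective (lines-unique n))
      (≡.sym (length-map hLine (lines es n)))
      (Allₚ.map⁺ (All.map (lines-complete ∘ scaled-·-normalised lt (hd≈1 _))
                          (lines-normalised n)))

    flagL-hLine : ∀ (V : CFlag n) y → flagL V (h · proj₂ y) ≈F flagL V (proj₂ (hLine y))
    flagL-hLine V (p , l) =
      flagL-cong V (h p p) (h⁻¹ p p) (λ k → sym (unit-cancel (hd≈1 p) _)) (λ k → refl)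

  T-equivariant : ∀ {n} (x : Fin n → R.Carrier) qinv {h h⁻¹ : Mat n} →
                  IsLowerTriangular h → (h ⊗ h⁻¹) ≈M I → (V : CFlag n) →
                  act h (T es x qinv V) ≈L T es x qinv (λ i → h ▹ V i)
  T-equivariant {n} x qinv {h} lt hh⁻¹≈I V φ φ-resp = begin
    eval φ (act h (T es x qinv V))       ≡⟨ ≡.cong (eval φ) (map-∘ L) ⟨
    eval φ (map actEntry L)              ≡⟨ eval-map φ actEntry L ⟩
    sumMap Ψ₁ L                          ≈⟨ sumMap-cong Ψ₁≈Ψ∘hLine L ⟩
    sumMap (Ψ ∘ hLine lt hh⁻¹≈I) L       ≡⟨ ≡.cong (foldr R._+_ R.0#) (map-∘ L) ⟩
    sumMap Ψ (map (hLine lt hh⁻¹≈I) L)   ≈⟨ sumMap-↭ (Pivoted n) Ψ-resp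
                                                      (lines-↭-map-hLine lt hh⁻¹≈I) ⟨
    sumMap Ψ L                           ≡⟨ eval-map φ _ L ⟨
    eval φ (T es x qinv V')              ∎
    where
    open SetoidReasoning R.setoid
    L = lines es n
    V' : CFlag n
    V' i = h ▹ V i
    actEntry : Fin n × Vec n → R.Carrier × Flag n
    actEntry y = weight x qinv (proj₁ y) , actFlag h (flagL V (proj₂ y))
    Ψ₁ Ψ : Fin n × Vec n → R.Carrier
    Ψ₁ y = weight x qinv (proj₁ y) R.* φ (actFlag h (flagL V (proj₂ y)))
    Ψ  y = weight x qinv (proj₁ y) R.* φ (flagL V' (proj₂ y))
    Ψ₁≈Ψ∘hLine : ∀ y → Ψ₁ y R.≈ Ψ (hLine lt hh⁻¹≈I y)
    Ψ₁≈Ψ∘hLine y = R.*-congˡ (R.trans (φ-resp _ _ (actFlag-flagL h V (proj₂ y)))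
                                         (φ-resp _ _ (flagL-hLine lt hh⁻¹≈I V' y)))
    Ψ-resp : Ψ Preserves Setoid._≈_ (Pivoted n) ⟶ R._≈_
    Ψ-resp (≡.refl , l≋l′) = R.*-congˡ (φ-resp _ _ (flagL-resp-≋ V' l≋l′))

lemma3p16 : ∀ {c ℓ c' ℓ' : Level} (K : Field c ℓ) (R : CommutativeRing c' ℓ')
    (q : ℕ) → IsPrimePower q → (E : HasOrder K q) →
    (n : ℕ) → 1 ≤ n →
    let open LinAlg K
        open Operator K R
        open HasOrder E using (elems)
    in (x : Fin n → R.Carrier) → ∑R x R.≈ R.1# →
       (qinv : R.Carrier) → (natR q R.* qinv) R.≈ R.1# →
       (h : Mat n) → InBminus h →
       (g : Mat n) → IsInvertible g →
       act h (T elems x qinv (cosetFlag g)) ≈L T elems x qinv (cosetFlag (h ⊗ g))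
lemma3p16 K R q _ E n _ x _ qinv _ h ((h⁻¹ , hh⁻¹≈I , _) , lt) g _ =
  Equivariance.T-equivariant K R complete distinct x qinv lt hh⁻¹≈I (LinAlg.cosetFlag K g)
  where open HasOrder E using (complete; distinct)
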